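{- Let $k\ge1$. Given $\mathcal F\subseteq\mathrm{FIN}_k^{<\infty}$, a semiselective coideal $\mathcal H\subseteq\mathrm{FIN}_k^\infty$ and $A\in\mathcal H$, there exists $B\in\mathcal H\upharpoonright A$ such that one of the following holds: (1) $(\mathrm{FIN}_k^{<\infty}\upharpoonright B)\cap\mathcal F=\emptyset$; or (2) for every $C\in[\emptyset,B]$ there is $n\in\mathbb N$ with $r_n(C)\in\mathcal F$.
   Context: $\mathrm{FIN}_k$ is the set of $p:\mathbb N\to\{0,\dots,k\}$ with finite support $\mathrm{supp}(p)=\{n:p(n)\ne0\}$ and $k$ in the range; $p<q$ means $\max\mathrm{supp}(p)<\min\mathrm{supp}(q)$. $\mathrm{FIN}_k^\infty$ / $\mathrm{FIN}_k^{<\infty}$: infinite / finite block sequences $(p_n)$ with $p_n<p_{n+1}$; $\mathrm{FIN}_k^{[d]}$: those of length $d$. $T(p)(n)=\max\{p(n)-1,0\}$. For a block sequence $A=(p_n)$, $[A]$ is the set of $T^{(i_0)}(p_{n_0})+\dots+T^{(i_l)}(p_{n_l})$ with $n_0<\dots<n_l$, $i_j\in\{0,\dots,k\}$, some $i_j=0$. $X\le Y$: every element of $X$ in $[Y]$. $r_n(A)$: first $n$ elements ($r_0(A)=\emptyset$); $[a,A]=\{B:\exists n\ r_n(B)=a,\ B\le A\}$ (so $[\emptyset,B]=\{C\in\mathrm{FIN}_k^\infty:C\le B\}$); $[n,A]=[r_n(A),A]$; $r_n[a,A]=\{r_n(B):B\in[a,A]\}$; $\mathrm{FIN}_k^{<\infty}\upharpoonright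 A=\{a:[a,A]\ne\emptyset\}$; $\mathrm{depth}_A(a)=\min\{n:a\le r_n(A)\}$; $\mathcal H\upharpoonright A=\{B\in\mathcal H:B\le A\}$. A coideal is $\mathcal H\subseteq\mathrm{FIN}_k^\infty$ such that: (a) $A\in\mathcal H$ and $A\triangle B$ finite imply $B\in\mathcal H$; (b) $A\in\mathcal H$, $A\le B$ imply $B\in\mathcal H$; (c) for $A\in\mathcal H$, $a\in\mathrm{FIN}_k^{<\infty}\upharpoonright A$: $[a,B]\ne\emptyset$ for all $B\in[\mathrm{depth}_A(a),A]\cap\mathcal H$, and if $B\in\mathcal H\upharpoonright A$, $[a,B]\ne\emptyset$, then some $A'\in[\mathrm{depth}_A(a),A]\cap\mathcal H$ has $\emptyset\ne[a,A']\subseteq[a,B]$; (d) for $A\in\mathcal H$, $a\in\mathrm{FIN}_k^{<\infty}\upharpoonright A$, $\mathcal O\subseteq\mathrm{FIN}_k^{[|a|+1]}$, some $B\in[\mathrm{depth}_A(a),A]\cap\mathcal H$ has $r_{|a|+1}[a,B]\subseteq\mathcal O$ or disjoint from $\mathcal O$. $\mathcal D\subseteq\mathcal S\subseteq\mathcal H$ is dense open in $\mathcal S$ if every $A\in\mathcal S$ has $B\in\mathcal D$, $B\le A$, and $A\in\mathcal S$, $B\in\mathcal D$, $A\le B$ imply $A\in\mathcal D$. $\mathcal H$ is semiselective if for every $A\in\mathcal H$, every family $(\mathcal D_a)_{a\in\mathrm{FIN}_k^{<\infty}\upharpoonright A}$ with $\mathcal D_a$ dense open in $\mathcal H\cap[\mathrm{depth}_A(a),A]$,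 and every $C\in\mathcal H\upharpoonright A$, there are $B\in\mathcal H\upharpoonright C$ and $A_a\in\mathcal D_a$ with $[a,B]\subseteq[a,A_a]$ for all $a\in\mathrm{FIN}_k^{<\infty}\upharpoonright B$. -}

module Defs where

open import Level using (0ℓ) renaming (suc to lsuc)
open import Data.Nat using (ℕ; zero; suc; _∸_; _+_; _≤_; _<_; _≤ᵇ_; _≡ᵇ_)
open import Data.Bool using (Bool; true; false; _∧_; not; T)
open import Data.List using (List; []; _∷_; length)
open import Data.Bool.ListAction using (all; any)
open import Data.List.Relation.Unary.All using (All)
open import Data.List.Relation.Unary.Any using (Any)
open import Data.List.Membership.Propositional using (_∈_)
open import Data.Product using (Σ; ∃; _×_; _,_; proj₁; proj₂)
open import Data.Sum using (_⊎_)
open import Data.Unit using (⊤)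
open import Relation.Nullary using (¬_)
open import Relation.Binary.PropositionalEquality using (_≡_)

-- An element p : ℕ → {0,…,k} with finite support and k in its
-- range is represented canonically by the list (p 0, p 1, …, p m) where
-- m = max supp p (so the last entry is nonzero).  Canonicity makes
-- propositional equality ≡ coincide with equality of functions.

lastNonzero : List ℕ → Bool
lastNonzero [] = false
lastNonzero (x ∷ []) = not (x ≡ᵇ 0)
lastNonzero (x ∷ y ∷ r) = lastNonzero (y ∷ r)

validᵇ : ℕ → List ℕ → Bool
validᵇ k l = all (λ x → x ≤ᵇ k) l ∧ (any (λ x → x ≡ᵇ k) l ∧ lastNonzero l)

FIN : ℕ → Set
FIN k = Σ (List ℕ) (λ l → T (validᵇ k l))

at : List ℕ → ℕ → ℕ
at [] n = 0
at (x ∷ l) zero = x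
at (x ∷ l) (suc n) = at l n

val : {k : ℕ} → FIN k → ℕ → ℕ
val p n = at (proj₁ p) n

leadingZeros : List ℕ → ℕ
leadingZeros [] = 0
leadingZeros (zero ∷ l) = suc (leadingZeros l)
leadingZeros (suc _ ∷ l) = 0

-- p < q  iff  max supp p < min supp q; with the canonical representation
-- max supp p = length − 1 and min supp q = number of leading zeros of q.
_<ᵇ_ : {k : ℕ} → FIN k → FIN k → Bool
p <ᵇ q = length (proj₁ p) ≤ᵇ leadingZeros (proj₁ q)

-- Infinite block sequences FIN_k^∞.  Finite block sequences are
-- represented by lists of elements of FIN_k (the block condition is
-- automatic wherever finite sequences occur, namely as r_n(B)).

record BS (k : ℕ) : Set where
  field
    seq : ℕ → FIN k
    blk : (n : ℕ) → T (seq n <ᵇ seq (suc n))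
open BS public

-- A combination is a list of pairs (n_j , i_j), standing
-- for T^(i_0)(p_{n_0}) + … + T^(i_l)(p_{n_l}), with n_0 < … < n_l,
-- i_j ∈ {0,…,k} and some i_j = 0.  Note T^(i)(p)(m) = p(m) ∸ i.

IncIdx : List (ℕ × ℕ) → Set
IncIdx [] = ⊤
IncIdx (x ∷ []) = ⊤
IncIdx ((n , i) ∷ (m , j) ∷ r) = (n < m) × IncIdx ((m , j) ∷ r)

combVal : {k : ℕ} → (ℕ → FIN k) → List (ℕ × ℕ) → ℕ → ℕ
combVal f [] m = 0
combVal f ((n , i) ∷ c) m = (val (f n) m ∸ i) + combVal f c m

InSpanBelow : {k : ℕ} → (ℕ → FIN k) → ℕ → FIN k → Set
InSpanBelow {k} f N p =
  Σ (List (ℕ × ℕ)) λ c →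
    IncIdx c × All (λ x → (proj₁ x < N) × (proj₂ x ≤ k)) c
    × Any (λ x → proj₂ x ≡ 0) c
    × ((m : ℕ) → val p m ≡ combVal f c m)

InSpan : {k : ℕ} → BS k → FIN k → Set
InSpan A p = ∃ λ N → InSpanBelow (seq A) N p

_≤ᴮ_ : {k : ℕ} → BS k → BS k → Set
B ≤ᴮ A = (n : ℕ) → InSpan A (seq B n)

_≤r[_]_ : {k : ℕ} → List (FIN k) → ℕ → BS k → Set
a ≤r[ N ] A = All (InSpanBelow (seq A) N) a

rFrom : {k : ℕ} → BS k → ℕ → ℕ → List (FIN k)
rFrom A zero i = []
rFrom A (suc n) i = seq A i ∷ rFrom A n (suc i)

r : {k : ℕ} → ℕ → BS k → List (FIN k)
r n A = rFrom A n 0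

Cone : {k : ℕ} → List (FIN k) → BS k → BS k → Set
Cone a A B = (∃ λ n → r n B ≡ a) × (B ≤ᴮ A)

ConeN : {k : ℕ} → ℕ → BS k → BS k → Set
ConeN n A = Cone (r n A) A

Restr : {k : ℕ} → BS k → List (FIN k) → Set
Restr A a = ∃ λ B → Cone a A B

Depth : {k : ℕ} → BS k → List (FIN k) → ℕ → Set
Depth A a d = (a ≤r[ d ] A) × ((m : ℕ) → m < d → ¬ (a ≤r[ m ] A))

rCone : {k : ℕ} → ℕ → List (FIN k) → BS k → List (FIN k) → Set
rCone n a A b = ∃ λ B → Cone a A B × (r n B ≡ b)

_∈ᴮ_ : {k : ℕ} → FIN k → BS k → Set
p ∈ᴮ A = ∃ λ n → seq A n ≡ p

FinDiff : {k : ℕ} → BS k → BS k → Set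
FinDiff {k} A B = Σ (List (FIN k)) λ F → (p : FIN k) →
  ((p ∈ᴮ A × ¬ (p ∈ᴮ B)) ⊎ (p ∈ᴮ B × ¬ (p ∈ᴮ A))) → p ∈ F

IsCoideal : {k : ℕ} → (BS k → Set) → Set₁
IsCoideal {k} H =
  ((A B : BS k) → H A → FinDiff A B → H B)
  × ((A B : BS k) → H A → A ≤ᴮ B → H B)
  -- (c)
  × ((A : BS k) → H A → (a : List (FIN k)) → Restr A a → (d : ℕ) → Depth A a d →
       ((B : BS k) → ConeN d A B → H B → ∃ λ C → Cone a B C)
     × ((B : BS k) → H B → B ≤ᴮ A → (∃ λ C → Cone a B C) →
          ∃ λ A' → ConeN d A A' × H A' × (∃ λ C → Cone a A' C)
                   × ((C : BS k) → Cone a A' C → Cone a B C)))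
  -- (d)
  × ((A : BS k) → H A → (a : List (FIN k)) → Restr A a → (d : ℕ) → Depth A a d →
       (O : List (FIN k) → Set) →
       ∃ λ B → ConeN d A B × H B ×
         (((b : List (FIN k)) → rCone (suc (length a)) a B b → O b)
          ⊎ ((b : List (FIN k)) → rCone (suc (length a)) a B b → ¬ O b)))

DenseOpen : {k : ℕ} → (BS k → Set) → (BS k → Set) → Set
DenseOpen {k} D S =
  ((A : BS k) → D A → S A)
  × ((A : BS k) → S A → ∃ λ B → D B × B ≤ᴮ A)
  × ((A B : BS k) → S A → D B → A ≤ᴮ B → D A)

IsSemiselective : {k : ℕ} → (BS k → Set) → Set₁
IsSemiselective {k} H =
  (A : BS k) → H A →
  (D : List (FIN k) → BS k → Set) →
  ((a : List (FIN k)) → Restr A a → (d : ℕ) → Depth A a d →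
     DenseOpen (D a) (λ B → H B × ConeN d A B)) →
  (C : BS k) → H C → C ≤ᴮ A →
  ∃ λ B → H B × B ≤ᴮ C ×
    ((a : List (FIN k)) → Restr B a →
       ∃ λ Aₐ → D a Aₐ × ((E : BS k) → Cone a B E → Cone a Aₐ E))

-- A Galvin–Prikry accept/reject argument.  X accepts a if every C ∈ [a, X] has an initial
-- segment in F.  A first use of semiselectivity, on the dense open sets of X that either
-- accept a or have no accepting H-subset, gives B ∈ H ↾ A that decides every a: B accepts a,
-- or no Y ∈ H with ∅ ≠ [a, Y] ⊆ [a, B] accepts a (here H's closure under finite changes lets
-- one pass from an element of [a, Y] to a member of H in it).  If B accepts ∅ we are in case
-- (2).  Otherwise property (d) of coideals makes "all one-step extensions of a rejected a are
-- rejected" dense open, and a second use of semiselectivity gives B' ≤ B on which every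
-- a ∈ FIN↾B' is rejected by induction on its length; a rejected a is not in F, so case (1).
-- Transitivity of ≤ on block sequences rests on blocks having disjoint supports: a
-- combination is then a pointwise maximum, and combinations of combinations normalise.

module Submission where

open import Defs
open import Level using (0ℓ; Lift; lift) renaming (suc to lsuc)
open import Axiom.ExcludedMiddle using (ExcludedMiddle)
open import Data.Nat using (ℕ; zero; suc; _∸_; _+_; _≤_; _<_; _≤ᵇ_; _≡ᵇ_; _⊔_; _⊓_; z≤n; s≤s; z<s; _≟_; _<?_; _≤?_)
open import Data.Nat.Properties
open import Algebra.Properties.CommutativeSemigroup ⊔-commutativeSemigroup using () renaming (interchange to ⊔-interchange)
open import Data.Bool using (Bool; T; _∧_)
open import Data.Bool.ListAction using (all; any)
open import Data.Bool.Properties using (T-∧)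
open import Data.List using (List; []; _∷_; length; _++_; map)
open import Data.List.Properties using (∷-injective)
open import Data.List.Relation.Unary.All as All using (All; []; _∷_)
open import Data.List.Relation.Unary.Any as Any using (Any; here; there)
open import Data.List.Relation.Unary.Any.Properties using (++⁺ˡ; ++⁺ʳ; map⁺)
open import Data.List.Membership.Propositional using (_∈_; find; lose)
open import Data.Product using (∃; _×_; _,_; proj₁; proj₂; map₂)
open import Data.Sum using (_⊎_; inj₁; inj₂)
open import Data.Unit using (tt)
open import Data.Empty using (⊥-elim)
open import Function.Base using (_∘_; case_of_)
open import Function.Bundles using (Equivalence)
open import Relation.Nullary using (¬_; Dec; yes; no)
open import Relation.Binary.PropositionalEquality
open import Relation.Binary.Definitions using (tri<; tri≈; tri>)

∧-elim : (x y : Bool) → T (x ∧ y) → T x × T y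
∧-elim x y = Equivalence.to (T-∧ {x} {y})

at≤ : (k : ℕ) (l : List ℕ) → T (all (λ x → x ≤ᵇ k) l) → (m : ℕ) → at l m ≤ k
at≤ k [] _ m = z≤n
at≤ k (x ∷ l) v zero = ≤ᵇ⇒≤ x k (proj₁ (∧-elim (x ≤ᵇ k) _ v))
at≤ k (x ∷ l) v (suc m) = at≤ k l (proj₂ (∧-elim (x ≤ᵇ k) _ v)) m

val≤ : {k : ℕ} (p : FIN k) (m : ℕ) → val p m ≤ k
val≤ {k} (l , v) = at≤ k l (proj₁ (∧-elim (all (λ x → x ≤ᵇ k) l) _ v))

lastNonzero-FIN : {k : ℕ} (p : FIN k) → T (lastNonzero (proj₁ p))
lastNonzero-FIN {k} (l , v) =
  proj₂ (∧-elim (any (λ x → x ≡ᵇ k) l) _ (proj₂ (∧-elim (all (λ x → x ≤ᵇ k) l) _ v)))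

leadingZeros<length : (l : List ℕ) → T (lastNonzero l) → leadingZeros l < length l
leadingZeros<length (zero ∷ []) ()
leadingZeros<length (suc x ∷ []) _ = z<s
leadingZeros<length (zero ∷ y ∷ l) t = s≤s (leadingZeros<length (y ∷ l) t)
leadingZeros<length (suc x ∷ y ∷ l) _ = z<s

at-beyond-length : (l : List ℕ) (m : ℕ) → length l ≤ m → at l m ≡ 0
at-beyond-length [] m _ = refl
at-beyond-length (x ∷ l) (suc m) (s≤s h) = at-beyond-length l m h

at-below-leadingZeros : (l : List ℕ) (m : ℕ) → m < leadingZeros l → at l m ≡ 0
at-below-leadingZeros (zero ∷ l) zero _ = refl
at-below-leadingZeros (zero ∷ l) (suc m) (s≤s h) = at-below-leadingZeros l m h

module _ {k : ℕ} (A : BS k) where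

  private
    len lz : ℕ → ℕ
    len n = length (proj₁ (seq A n))
    lz n = leadingZeros (proj₁ (seq A n))

    len≤lz-next : (n : ℕ) → len n ≤ lz (suc n)
    len≤lz-next n = ≤ᵇ⇒≤ _ _ (blk A n)

    lz<len : (n : ℕ) → lz n < len n
    lz<len n = leadingZeros<length _ (lastNonzero-FIN (seq A n))

    len≤lz : {n n' : ℕ} → n < n' → len n ≤ lz n'
    len≤lz {n} {suc n'} (s≤s n≤n') with m≤n⇒m<n∨m≡n n≤n'
    ... | inj₂ refl = len≤lz-next n
    ... | inj₁ n<n' = ≤-trans (len≤lz n<n') (≤-trans (<⇒≤ (lz<len n')) (len≤lz-next n'))

  index≤leadingZeros : (j : ℕ) → j ≤ leadingZeros (proj₁ (seq A j))
  index≤leadingZeros zero = z≤n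
  index≤leadingZeros (suc j) = ≤-trans (<-≤-trans (s≤s (index≤leadingZeros j)) (lz<len j)) (len≤lz-next j)

  blocks-disjoint : {n n' : ℕ} (m : ℕ) → n < n' → 0 < val (seq A n) m → val (seq A n') m ≡ 0
  blocks-disjoint {n} m n<n' pos with len n ≤? m
  ... | yes len≤m = ⊥-elim (<⇒≢ pos (sym (at-beyond-length (proj₁ (seq A n)) m len≤m)))
  ... | no len≰m = at-below-leadingZeros _ m (<-≤-trans (≰⇒> len≰m) (len≤lz n<n'))

maxComb : {k : ℕ} → (ℕ → FIN k) → List (ℕ × ℕ) → ℕ → ℕ
maxComb f [] m = 0
maxComb f ((n , i) ∷ c) m = (val (f n) m ∸ i) ⊔ maxComb f c m

maxComb-vanishes : {k : ℕ} (f : ℕ → FIN k) (m : ℕ) (c : List (ℕ × ℕ)) →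
                   All (λ x → val (f (proj₁ x)) m ≡ 0) c → maxComb f c m ≡ 0
maxComb-vanishes f m [] [] = refl
maxComb-vanishes f m ((n , i) ∷ c) (z ∷ zs) rewrite z | 0∸n≡0 i = maxComb-vanishes f m c zs

IncIdx-tail : {x : ℕ × ℕ} (c : List (ℕ × ℕ)) → IncIdx (x ∷ c) → IncIdx c
IncIdx-tail [] _ = tt
IncIdx-tail (_ ∷ _) (_ , inc) = inc

IncIdx-head< : (n i : ℕ) (c : List (ℕ × ℕ)) → IncIdx ((n , i) ∷ c) → All (λ x → n < proj₁ x) c
IncIdx-head< n i [] _ = []
IncIdx-head< n i ((n' , i') ∷ c) (n<n' , inc) =
  n<n' ∷ All.map (<-trans n<n') (IncIdx-head< n' i' c inc)

+≡⊔ : (x y : ℕ) → x ≡ 0 ⊎ y ≡ 0 → x + y ≡ x ⊔ y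
+≡⊔ .0 y (inj₁ refl) = refl
+≡⊔ x .0 (inj₂ refl) = trans (+-identityʳ x) (sym (⊔-identityʳ x))

-- Blocks have disjoint supports, so at each m at most one summand is nonzero.
combVal≡maxComb : {k : ℕ} (A : BS k) (c : List (ℕ × ℕ)) → IncIdx c → (m : ℕ) →
                  combVal (seq A) c m ≡ maxComb (seq A) c m
combVal≡maxComb A [] _ m = refl
combVal≡maxComb A ((n , i) ∷ c) inc m =
  trans (cong (_ +_) (combVal≡maxComb A c (IncIdx-tail c inc) m)) (+≡⊔ _ _ head-or-tail-vanishes)
  where
  head-or-tail-vanishes : (val (seq A n) m ∸ i ≡ 0) ⊎ (maxComb (seq A) c m ≡ 0)
  head-or-tail-vanishes with val (seq A n) m in eq
  ... | zero = inj₁ (0∸n≡0 i)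
  ... | suc _ = inj₂ (maxComb-vanishes (seq A) m c
                  (All.map (λ n<n' → blocks-disjoint A m n<n' (subst (0 <_) (sym eq) z<s))
                           (IncIdx-head< n i c inc)))

maxOver : (ℕ → ℕ) → ℕ → ℕ → ℕ
maxOver h s zero = 0
maxOver h s (suc N) = h s ⊔ maxOver h (suc s) N

maxOver-cong : {h g : ℕ → ℕ} → (∀ x → h x ≡ g x) → (s N : ℕ) → maxOver h s N ≡ maxOver g s N
maxOver-cong h≗g s zero = refl
maxOver-cong h≗g s (suc N) = cong₂ _⊔_ (h≗g s) (maxOver-cong h≗g (suc s) N)

maxOver-zero : {h : ℕ → ℕ} (s N : ℕ) → (∀ x → s ≤ x → h x ≡ 0) → maxOver h s N ≡ 0
maxOver-zero s zero _ = refl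
maxOver-zero s (suc N) h≗0 rewrite h≗0 s ≤-refl = maxOver-zero (suc s) N (λ x s<x → h≗0 x (<⇒≤ s<x))

maxOver-⊔ : (h g : ℕ → ℕ) (s N : ℕ) → maxOver (λ x → h x ⊔ g x) s N ≡ maxOver h s N ⊔ maxOver g s N
maxOver-⊔ h g s zero = refl
maxOver-⊔ h g s (suc N) =
  trans (cong ((h s ⊔ g s) ⊔_) (maxOver-⊔ h g (suc s) N))
        (⊔-interchange (h s) (g s) (maxOver h (suc s) N) (maxOver g (suc s) N))

δ : ℕ → ℕ → ℕ → ℕ
δ n v x with n ≟ x
... | yes _ = v
... | no _ = 0

maxOver-δ-below : (n v s N : ℕ) → n < s → maxOver (δ n v) s N ≡ 0
maxOver-δ-below n v s N n<s = maxOver-zero s N vanishes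
  where
  vanishes : ∀ x → s ≤ x → δ n v x ≡ 0
  vanishes x s≤x with n ≟ x
  ... | yes refl = ⊥-elim (<⇒≱ n<s s≤x)
  ... | no _ = refl

maxOver-δ : (n v s N : ℕ) → s ≤ n → n < s + N → maxOver (δ n v) s N ≡ v
maxOver-δ n v s zero s≤n n<s+0 = ⊥-elim (<⇒≱ n<s+0 (subst (_≤ n) (sym (+-identityʳ s)) s≤n))
maxOver-δ n v s (suc N) s≤n n<s+N with n ≟ s
... | yes refl = trans (cong (v ⊔_) (maxOver-δ-below n v (suc n) N (n<1+n n))) (⊔-identityʳ v)
... | no n≢s = maxOver-δ n v (suc s) N (≤∧≢⇒< s≤n (n≢s ∘ sym)) (subst (n <_) (+-suc s N) n<s+N)

-- k when x does not occur in c: T^(k) kills every block.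
minExp : ℕ → List (ℕ × ℕ) → ℕ → ℕ
minExp k [] x = k
minExp k ((n , i) ∷ c) x with n ≟ x
... | yes _ = i ⊓ minExp k c x
... | no _ = minExp k c x

minExp≤k : (k : ℕ) (c : List (ℕ × ℕ)) (x : ℕ) → minExp k c x ≤ k
minExp≤k k [] x = ≤-refl
minExp≤k k ((n , i) ∷ c) x with n ≟ x
... | yes _ = ≤-trans (m⊓n≤n i _) (minExp≤k k c x)
... | no _ = minExp≤k k c x

minExp≤ : (k : ℕ) (c : List (ℕ × ℕ)) {n i : ℕ} → (n , i) ∈ c → minExp k c n ≤ i
minExp≤ k ((n' , i') ∷ c) {n} (here refl) with n ≟ n
... | yes _ = m⊓n≤m i' _
... | no n≢n = ⊥-elim (n≢n refl)
minExp≤ k ((n' , i') ∷ c) {n} (there n,i∈c) with n' ≟ n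
... | yes _ = ≤-trans (m⊓n≤n i' _) (minExp≤ k c n,i∈c)
... | no _ = minExp≤ k c n,i∈c

module _ {k : ℕ} (f : ℕ → FIN k) (m : ℕ) where

  private
    minExp-cons : (n i : ℕ) (c : List (ℕ × ℕ)) (x : ℕ) →
                  val (f x) m ∸ minExp k ((n , i) ∷ c) x
                    ≡ (val (f x) m ∸ minExp k c x) ⊔ δ n (val (f n) m ∸ i) x
    minExp-cons n i c x with n ≟ x
    ... | yes refl = trans (∸-distribˡ-⊓-⊔ (val (f n) m) i (minExp k c n)) (⊔-comm (val (f n) m ∸ i) _)
    ... | no _ = sym (⊔-identityʳ _)

  maxComb≡maxOver-minExp : (N : ℕ) (c : List (ℕ × ℕ)) → All (λ x → proj₁ x < N) c →
                           maxComb f c m ≡ maxOver (λ x → val (f x) m ∸ minExp k c x) 0 N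
  maxComb≡maxOver-minExp N [] [] = sym (maxOver-zero 0 N (λ x _ → m≤n⇒m∸n≡0 (val≤ (f x) m)))
  maxComb≡maxOver-minExp N ((n , i) ∷ c) (n<N ∷ c<N) = begin
    v ⊔ maxComb f c m                     ≡⟨ cong (v ⊔_) (maxComb≡maxOver-minExp N c c<N) ⟩
    v ⊔ maxOver h 0 N                     ≡⟨ ⊔-comm v (maxOver h 0 N) ⟩
    maxOver h 0 N ⊔ v                     ≡⟨ cong (maxOver h 0 N ⊔_) (maxOver-δ n v 0 N z≤n n<N) ⟨
    maxOver h 0 N ⊔ maxOver (δ n v) 0 N   ≡⟨ maxOver-⊔ h (δ n v) 0 N ⟨
    maxOver (λ x → h x ⊔ δ n v x) 0 N     ≡⟨ maxOver-cong (minExp-cons n i c) 0 N ⟨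
    maxOver (λ x → val (f x) m ∸ minExp k ((n , i) ∷ c) x) 0 N ∎
    where
    open ≡-Reasoning
    v = val (f n) m ∸ i
    h = λ x → val (f x) m ∸ minExp k c x

fullComb : (ℕ → ℕ) → ℕ → ℕ → List (ℕ × ℕ)
fullComb E s zero = []
fullComb E s (suc N) = (s , E s) ∷ fullComb E (suc s) N

maxComb-fullComb : {k : ℕ} (f : ℕ → FIN k) (E : ℕ → ℕ) (s N m : ℕ) →
                   maxComb f (fullComb E s N) m ≡ maxOver (λ x → val (f x) m ∸ E x) s N
maxComb-fullComb f E s zero m = refl
maxComb-fullComb f E s (suc N) m = cong (_ ⊔_) (maxComb-fullComb f E (suc s) N m)

IncIdx-fullComb : (E : ℕ → ℕ) (s N : ℕ) → IncIdx (fullComb E s N)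
IncIdx-fullComb E s zero = tt
IncIdx-fullComb E s (suc zero) = tt
IncIdx-fullComb E s (suc (suc N)) = n<1+n s , IncIdx-fullComb E (suc s) (suc N)

∈-fullComb⁺ : (E : ℕ → ℕ) {s N n : ℕ} → s ≤ n → n < s + N → (n , E n) ∈ fullComb E s N
∈-fullComb⁺ E {s} {zero} s≤n n<s+0 = ⊥-elim (<⇒≱ n<s+0 (subst (_≤ _) (sym (+-identityʳ s)) s≤n))
∈-fullComb⁺ E {s} {suc N} {n} s≤n n<s+N with n ≟ s
... | yes refl = here refl
... | no n≢s = there (∈-fullComb⁺ E (≤∧≢⇒< s≤n (n≢s ∘ sym)) (subst (n <_) (+-suc s N) n<s+N))

∈-fullComb⁻ : (E : ℕ → ℕ) {s N n i : ℕ} → (n , i) ∈ fullComb E s N → (n < s + N) × (i ≡ E n)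
∈-fullComb⁻ E {s} {suc N} (here refl) = subst (s <_) (sym (+-suc s N)) (s≤s (m≤m+n s N)) , refl
∈-fullComb⁻ E {s} {suc N} {n} (there n,i∈) with ∈-fullComb⁻ E n,i∈
... | n<s+N , i≡En = subst (n <_) (sym (+-suc s N)) n<s+N , i≡En

bound : List (ℕ × ℕ) → ℕ
bound [] = 0
bound ((n , _) ∷ c) = suc n ⊔ bound c

∈⇒<bound : {c : List (ℕ × ℕ)} {n i : ℕ} → (n , i) ∈ c → n < bound c
∈⇒<bound {(n , _) ∷ c} (here refl) = m≤m⊔n (suc n) (bound c)
∈⇒<bound {(n , _) ∷ c} (there n,i∈c) = <-≤-trans (∈⇒<bound n,i∈c) (m≤n⊔m (suc n) (bound c))

-- The exponents of c may exceed k and its indices may repeat or be unordered; the witness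
-- combination keeps, for every index below the bound of c, only its least exponent.
maxComb⇒InSpan : {k : ℕ} (A : BS k) (c : List (ℕ × ℕ)) → Any (λ x → proj₂ x ≡ 0) c →
                 (p : FIN k) → (∀ m → val p m ≡ maxComb (seq A) c m) → InSpan A p
maxComb⇒InSpan {k} A c zeroExp p p≡c =
  N , fullComb E 0 N , IncIdx-fullComb E 0 N ,
  All.tabulate (λ {x} → bounded x) ,
  lose (∈-fullComb⁺ E z≤n (∈⇒<bound n₀,0∈c)) (n≤0⇒n≡0 (subst (E n₀ ≤_) i₀≡0 (minExp≤ k c n₀,0∈c))) ,
  λ m → begin
    val p m                                     ≡⟨ p≡c m ⟩
    maxComb (seq A) c m                         ≡⟨ maxComb≡maxOver-minExp (seq A) m N c (All.tabulate ∈⇒<bound) ⟩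
    maxOver (λ x → val (seq A x) m ∸ E x) 0 N   ≡⟨ maxComb-fullComb (seq A) E 0 N m ⟨
    maxComb (seq A) (fullComb E 0 N) m          ≡⟨ combVal≡maxComb A (fullComb E 0 N) (IncIdx-fullComb E 0 N) m ⟨
    combVal (seq A) (fullComb E 0 N) m          ∎
  where
  open ≡-Reasoning
  N = bound c
  E = minExp k c
  n₀ = proj₁ (proj₁ (find zeroExp))
  n₀,0∈c = proj₁ (proj₂ (find zeroExp))
  i₀≡0 = proj₂ (proj₂ (find zeroExp))
  bounded : (x : ℕ × ℕ) → x ∈ fullComb E 0 N → (proj₁ x < N) × (proj₂ x ≤ k)
  bounded (n , i) n,i∈ with ∈-fullComb⁻ E n,i∈
  ... | n<N , refl = n<N , minExp≤k k c n

≤ᴮ-refl : {k : ℕ} (A : BS k) → A ≤ᴮ A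
≤ᴮ-refl A n = suc n , ((n , 0) ∷ []) , tt , ((n<1+n n , z≤n) ∷ []) , here refl , λ m → sym (+-identityʳ _)

raiseExp : ℕ → List (ℕ × ℕ) → List (ℕ × ℕ)
raiseExp j = map (map₂ (_+ j))

module _ {k : ℕ} (f : ℕ → FIN k) (m : ℕ) where

  maxComb-++ : (c d : List (ℕ × ℕ)) → maxComb f (c ++ d) m ≡ maxComb f c m ⊔ maxComb f d m
  maxComb-++ [] d = refl
  maxComb-++ ((n , i) ∷ c) d rewrite maxComb-++ c d = sym (⊔-assoc (val (f n) m ∸ i) _ _)

  maxComb-raiseExp : (j : ℕ) (c : List (ℕ × ℕ)) → maxComb f (raiseExp j c) m ≡ maxComb f c m ∸ j
  maxComb-raiseExp j [] = sym (0∸n≡0 j)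
  maxComb-raiseExp j ((n , i) ∷ c) = begin
    (val (f n) m ∸ (i + j)) ⊔ maxComb f (raiseExp j c) m
      ≡⟨ cong₂ _⊔_ (sym (∸-+-assoc (val (f n) m) i j)) (maxComb-raiseExp j c) ⟩
    (val (f n) m ∸ i ∸ j) ⊔ (maxComb f c m ∸ j)
      ≡⟨ sym (∸-distribʳ-⊔ j (val (f n) m ∸ i) (maxComb f c m)) ⟩
    ((val (f n) m ∸ i) ⊔ maxComb f c m) ∸ j
      ∎
    where open ≡-Reasoning

module _ {k : ℕ} (B A : BS k) (B≤A : B ≤ᴮ A) where

  private
    repr : ℕ → List (ℕ × ℕ)
    repr j = proj₁ (proj₂ (B≤A j))

    val≡maxComb-repr : (j m : ℕ) → val (seq B j) m ≡ maxComb (seq A) (repr j) m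
    val≡maxComb-repr j m with B≤A j
    ... | _ , c , inc , _ , _ , eq = trans (eq m) (combVal≡maxComb A c inc m)

    repr-zeroExp : (j : ℕ) → Any (λ x → proj₂ x ≡ 0) (repr j)
    repr-zeroExp j with B≤A j
    ... | _ , _ , _ , _ , zeroExp , _ = zeroExp

  -- T^(i) of a combination of blocks of A raises each of its exponents by i.
  compose : List (ℕ × ℕ) → List (ℕ × ℕ)
  compose [] = []
  compose ((j , i) ∷ c) = raiseExp i (repr j) ++ compose c

  maxComb-compose : (c : List (ℕ × ℕ)) (m : ℕ) → maxComb (seq B) c m ≡ maxComb (seq A) (compose c) m
  maxComb-compose [] m = refl
  maxComb-compose ((j , i) ∷ c) m = begin
    (val (seq B j) m ∸ i) ⊔ maxComb (seq B) c m
      ≡⟨ cong₂ _⊔_ (cong (_∸ i) (val≡maxComb-repr j m)) (maxComb-compose c m) ⟩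
    (maxComb (seq A) (repr j) m ∸ i) ⊔ maxComb (seq A) (compose c) m
      ≡⟨ cong (_⊔ _) (sym (maxComb-raiseExp (seq A) m i (repr j))) ⟩
    maxComb (seq A) (raiseExp i (repr j)) m ⊔ maxComb (seq A) (compose c) m
      ≡⟨ sym (maxComb-++ (seq A) m (raiseExp i (repr j)) (compose c)) ⟩
    maxComb (seq A) (compose ((j , i) ∷ c)) m
      ∎
    where open ≡-Reasoning

  compose-zeroExp : (c : List (ℕ × ℕ)) → Any (λ x → proj₂ x ≡ 0) c → Any (λ x → proj₂ x ≡ 0) (compose c)
  compose-zeroExp ((j , .0) ∷ c) (here refl) =
    ++⁺ˡ (map⁺ (Any.map (λ i≡0 → trans (+-identityʳ _) i≡0) (repr-zeroExp j)))
  compose-zeroExp ((j , i) ∷ c) (there zeroExp) = ++⁺ʳ (raiseExp i (repr j)) (compose-zeroExp c zeroExp)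

≤ᴮ-trans : {k : ℕ} {C B A : BS k} → C ≤ᴮ B → B ≤ᴮ A → C ≤ᴮ A
≤ᴮ-trans {C = C} {B} {A} C≤B B≤A t with C≤B t
... | _ , c , inc , _ , zeroExp , eq =
  maxComb⇒InSpan A (compose B A B≤A c) (compose-zeroExp B A B≤A c zeroExp) (seq C t) λ m → begin
    val (seq C t) m                     ≡⟨ eq m ⟩
    combVal (seq B) c m                 ≡⟨ combVal≡maxComb B c inc m ⟩
    maxComb (seq B) c m                 ≡⟨ maxComb-compose B A B≤A c m ⟩
    maxComb (seq A) (compose B A B≤A c) m ∎
  where open ≡-Reasoning

module _ {k : ℕ} where

  AgreeBelow : ℕ → BS k → BS k → Set
  AgreeBelow d X Y = (j : ℕ) → j < d → seq X j ≡ seq Y j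

  length-rFrom : (X : BS k) (n s : ℕ) → length (rFrom X n s) ≡ n
  length-rFrom X zero s = refl
  length-rFrom X (suc n) s = cong suc (length-rFrom X n (suc s))

  private
    rFrom-≡⇒seq-≡ : (X Y : BS k) (n s : ℕ) → rFrom X n s ≡ rFrom Y n s →
                    (i : ℕ) → i < n → seq X (i + s) ≡ seq Y (i + s)
    rFrom-≡⇒seq-≡ X Y (suc n) s eq zero _ = proj₁ (∷-injective eq)
    rFrom-≡⇒seq-≡ X Y (suc n) s eq (suc i) (s≤s i<n) =
      subst (λ j → seq X j ≡ seq Y j) (+-suc i s)
        (rFrom-≡⇒seq-≡ X Y n (suc s) (proj₂ (∷-injective eq)) i i<n)

    seq-≡⇒rFrom-≡ : (X Y : BS k) (n s : ℕ) → ((i : ℕ) → i < n → seq X (i + s) ≡ seq Y (i + s)) →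
                    rFrom X n s ≡ rFrom Y n s
    seq-≡⇒rFrom-≡ X Y zero s _ = refl
    seq-≡⇒rFrom-≡ X Y (suc n) s agree = cong₂ _∷_ (agree 0 z<s)
      (seq-≡⇒rFrom-≡ X Y n (suc s) λ i i<n →
        subst (λ j → seq X j ≡ seq Y j) (sym (+-suc i s)) (agree (suc i) (s≤s i<n)))

    ∈-rFrom : (X : BS k) (n s i : ℕ) → i < n → seq X (i + s) ∈ rFrom X n s
    ∈-rFrom X (suc n) s zero _ = here refl
    ∈-rFrom X (suc n) s (suc i) (s≤s i<n) =
      there (subst (λ j → seq X j ∈ rFrom X n (suc s)) (+-suc i s) (∈-rFrom X n (suc s) i i<n))

  r-≡⇒AgreeBelow : (d : ℕ) (X Y : BS k) → r d X ≡ r d Y → AgreeBelow d X Y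
  r-≡⇒AgreeBelow d X Y eq j j<d =
    subst (λ i → seq X i ≡ seq Y i) (+-identityʳ j) (rFrom-≡⇒seq-≡ X Y d 0 eq j j<d)

  AgreeBelow⇒r-≡ : (d : ℕ) (X Y : BS k) → AgreeBelow d X Y → r d X ≡ r d Y
  AgreeBelow⇒r-≡ d X Y agree =
    seq-≡⇒rFrom-≡ X Y d 0 (λ i i<d → agree (i + 0) (subst (_< d) (sym (+-identityʳ i)) i<d))

  ∈-r : (X : BS k) {n i : ℕ} → i < n → seq X i ∈ r n X
  ∈-r X {n} {i} i<n = subst (λ j → seq X j ∈ r n X) (+-identityʳ i) (∈-rFrom X n 0 i i<n)

  ConeN⇒r-≡ : (d : ℕ) (A X : BS k) → ConeN d A X → r d X ≡ r d A
  ConeN⇒r-≡ d A X ((n , rX≡rA) , _)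
    with trans (sym (length-rFrom X n 0)) (trans (cong length rX≡rA) (length-rFrom A d 0))
  ... | refl = rX≡rA

  ConeN-trans : (d : ℕ) {A X W : BS k} → ConeN d X W → ConeN d A X → ConeN d A W
  ConeN-trans d {A} {X} {W} W∈X X∈A =
    (d , trans (ConeN⇒r-≡ d X W W∈X) (ConeN⇒r-≡ d A X X∈A)) ,
    ≤ᴮ-trans {C = W} {X} {A} (proj₂ W∈X) (proj₂ X∈A)

  InSpanBelow-cong : (d : ℕ) {X Y : BS k} → AgreeBelow d X Y → {p : FIN k} →
                     InSpanBelow (seq X) d p → InSpanBelow (seq Y) d p
  InSpanBelow-cong d {X} {Y} agree (c , inc , bounded , zeroExp , eq) =
    c , inc , bounded , zeroExp , λ m → trans (eq m) (combVal-cong c bounded m)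
    where
    combVal-cong : (c : List (ℕ × ℕ)) → All (λ x → (proj₁ x < d) × (proj₂ x ≤ k)) c → (m : ℕ) →
                   combVal (seq X) c m ≡ combVal (seq Y) c m
    combVal-cong [] _ m = refl
    combVal-cong ((n , i) ∷ c) ((n<d , _) ∷ bounded) m =
      cong₂ _+_ (cong (λ q → val q m ∸ i) (agree n n<d)) (combVal-cong c bounded m)

  AgreeBelow-sym : {d : ℕ} {X Y : BS k} → AgreeBelow d X Y → AgreeBelow d Y X
  AgreeBelow-sym agree j j<d = sym (agree j j<d)

  Depth-cong : {d : ℕ} {X Y : BS k} {a : List (FIN k)} → AgreeBelow d X Y → Depth Y a d → Depth X a d
  Depth-cong {d} {X} {Y} agree (a≤rY , minimal) =
    All.map (λ {p} → InSpanBelow-cong d {Y} {X} (AgreeBelow-sym {d} {X} {Y} agree) {p}) a≤rY ,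
    λ m m<d a≤rX →
      minimal m m<d (All.map (λ {p} → InSpanBelow-cong m {X} {Y} (λ j j<m → agree j (<-trans j<m m<d)) {p}) a≤rX)

  Depth-unique : {A : BS k} {a : List (FIN k)} {d d' : ℕ} → Depth A a d → Depth A a d' → d ≡ d'
  Depth-unique {d = d} {d'} (a≤rd , minimal) (a≤rd' , minimal') with <-cmp d d'
  ... | tri< d<d' _ _ = ⊥-elim (minimal' d d<d' a≤rd)
  ... | tri≈ _ d≡d' _ = d≡d'
  ... | tri> _ _ d'<d = ⊥-elim (minimal d' d'<d a≤rd')

-- The first l blocks of C followed by a tail of W, starting far enough out to stay a block sequence.
module Splice {k : ℕ} (W C : BS k) (l : ℕ) where

  private
    e : ℕ
    e = length (proj₁ (seq C (l ∸ 1)))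

  spliced : ℕ → FIN k
  spliced n with n <? l
  ... | yes _ = seq C n
  ... | no _ = seq W (e + n)

  spliced-< : {n : ℕ} → n < l → spliced n ≡ seq C n
  spliced-< {n} n<l with n <? l
  ... | yes _ = refl
  ... | no n≮l = ⊥-elim (n≮l n<l)

  spliced-≥ : {n : ℕ} → l ≤ n → spliced n ≡ seq W (e + n)
  spliced-≥ {n} l≤n with n <? l
  ... | yes n<l = ⊥-elim (<⇒≱ n<l l≤n)
  ... | no _ = refl

  spliced-block : (n : ℕ) → T (spliced n <ᵇ spliced (suc n))
  spliced-block n with <-cmp (suc n) l
  ... | tri< 1+n<l _ _ rewrite spliced-< (<-trans (n<1+n n) 1+n<l) | spliced-< 1+n<l = blk C n
  ... | tri> _ _ l<1+n rewrite spliced-≥ (≤-pred l<1+n) | spliced-≥ (<⇒≤ l<1+n) | +-suc e n = blk W (e + n)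
  ... | tri≈ _ 1+n≡l _
    rewrite spliced-< (subst (n <_) 1+n≡l (n<1+n n)) | spliced-≥ (≤-reflexive (sym 1+n≡l)) =
    ≤⇒≤ᵇ (begin
      length (proj₁ (seq C n))                   ≡⟨ cong (λ j → length (proj₁ (seq C j))) (cong (_∸ 1) 1+n≡l) ⟩
      e                                          ≤⟨ m≤m+n e (suc n) ⟩
      e + suc n                                  ≤⟨ index≤leadingZeros W (e + suc n) ⟩
      leadingZeros (proj₁ (seq W (e + suc n)))   ∎)
    where open ≤-Reasoning

  W' : BS k
  W' = record { seq = spliced ; blk = spliced-block }

  r-W' : r l W' ≡ r l C
  r-W' = AgreeBelow⇒r-≡ l W' C (λ j j<l → spliced-< j<l)

  W'≤W : C ≤ᴮ W → W' ≤ᴮ W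
  W'≤W C≤W n with l ≤? n
  ... | yes l≤n = subst (InSpan W) (sym (spliced-≥ l≤n)) (≤ᴮ-refl W (e + n))
  ... | no l≰n = subst (InSpan W) (sym (spliced-< (≰⇒> l≰n))) (C≤W n)

  private
    dropped : (p : FIN k) (j : ℕ) → seq W j ≡ p → ¬ (p ∈ᴮ W') → p ∈ r l C ++ r (e + l) W
    dropped p j Wj≡p p∉W' with j <? e + l
    ... | yes j<e+l = ++⁺ʳ (r l C) (subst (_∈ r (e + l) W) Wj≡p (∈-r W j<e+l))
    ... | no j≮e+l =
      ⊥-elim (p∉W' (j ∸ e , trans (spliced-≥ l≤j∸e) (trans (cong (seq W) e+[j∸e]≡j) Wj≡p)))
      where
      l≤j∸e : l ≤ j ∸ e
      l≤j∸e = subst (_≤ j ∸ e) (m+n∸m≡n e l) (∸-monoˡ-≤ e (≮⇒≥ j≮e+l))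
      e+[j∸e]≡j : e + (j ∸ e) ≡ j
      e+[j∸e]≡j = m+[n∸m]≡n (≤-trans (m≤m+n e l) (≮⇒≥ j≮e+l))
    added : (p : FIN k) (n : ℕ) → spliced n ≡ p → ¬ (p ∈ᴮ W) → p ∈ r l C ++ r (e + l) W
    added p n W'n≡p p∉W with l ≤? n
    ... | yes l≤n = ⊥-elim (p∉W (e + n , trans (sym (spliced-≥ l≤n)) W'n≡p))
    ... | no l≰n = ++⁺ˡ (subst (_∈ r l C) (trans (sym (spliced-< (≰⇒> l≰n))) W'n≡p) (∈-r C (≰⇒> l≰n)))

  finDiff : FinDiff W W'
  finDiff = r l C ++ r (e + l) W , λ where
    p (inj₁ ((j , Wj≡p) , p∉W')) → dropped p j Wj≡p p∉W'
    p (inj₂ ((n , W'n≡p) , p∉W)) → added p n W'n≡p p∉W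

module Dichotomy (em : ExcludedMiddle (lsuc 0ℓ)) {k : ℕ} (F : List (FIN k) → Set)
                 (H : BS k → Set) (coideal : IsCoideal H) where

  private
    decide : (P : Set) → Dec P
    decide P with em {Lift (lsuc 0ℓ) P}
    ... | yes (lift p) = yes p
    ... | no ¬p = no (λ p → ¬p (lift p))

    H-finDiff : {X Y : BS k} → H X → FinDiff X Y → H Y
    H-finDiff {X} {Y} = proj₁ coideal X Y

    module _ {A : BS k} (HA : H A) {a : List (FIN k)} (a∈A : Restr A a) {d : ℕ} (depth : Depth A a d) where

      H-cone-nonempty : (X : BS k) → ConeN d A X → H X → Restr X a
      H-cone-nonempty = proj₁ (proj₁ (proj₂ (proj₂ coideal)) A HA a a∈A d depth)

      H-cone-shrink : (Y : BS k) → H Y → Y ≤ᴮ A → Restr Y a →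
                      ∃ λ A' → ConeN d A A' × H A' × Restr A' a × ((C : BS k) → Cone a A' C → Cone a Y C)
      H-cone-shrink = proj₂ (proj₁ (proj₂ (proj₂ coideal)) A HA a a∈A d depth)

      H-one-step : (O : List (FIN k) → Set) →
                   ∃ λ B → ConeN d A B × H B ×
                     (((b : List (FIN k)) → rCone (suc (length a)) a B b → O b)
                      ⊎ ((b : List (FIN k)) → rCone (suc (length a)) a B b → ¬ O b))
      H-one-step = proj₂ (proj₂ (proj₂ coideal)) A HA a a∈A d depth

      restrict-to-ConeN : {X : BS k} → ConeN d A X → H X → Restr X a × Depth X a d
      restrict-to-ConeN {X} X∈A HX =
        H-cone-nonempty X X∈A HX ,
        Depth-cong {X = X} {Y = A} (r-≡⇒AgreeBelow d X A (ConeN⇒r-≡ d A X X∈A)) depth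

  _⊆[_]_ : BS k → List (FIN k) → BS k → Set
  Y ⊆[ a ] X = (C : BS k) → Cone a Y C → Cone a X C

  record Accepts (X : BS k) (a : List (FIN k)) : Set where
    constructor accepts
    field prefix-in-F : (C : BS k) → Cone a X C → ∃ λ n → F (r n C)
  open Accepts public

  RejectsBelow : BS k → List (FIN k) → Set
  RejectsBelow X a = (Y : BS k) → H Y → Y ≤ᴮ X → Restr Y a → ¬ Accepts Y a

  -- Relative to cones, since semiselectivity only gives [b, B] ⊆ [b, A_b], not B ≤ A_b.
  Rejects : BS k → List (FIN k) → Set
  Rejects X a = (Y : BS k) → H Y → Restr Y a → Y ⊆[ a ] X → ¬ Accepts Y a

  ≤ᴮ⇒⊆ : (Y X : BS k) {a : List (FIN k)} → Y ≤ᴮ X → Y ⊆[ a ] X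
  ≤ᴮ⇒⊆ Y X Y≤X C (a⊑C , C≤Y) = a⊑C , ≤ᴮ-trans {C = C} {Y} {X} C≤Y Y≤X

  Accepts-⊆ : {Y X : BS k} {a : List (FIN k)} → Y ⊆[ a ] X → Accepts X a → Accepts Y a
  Accepts-⊆ Y⊆X acc = accepts λ C C∈Y → prefix-in-F acc C (Y⊆X C C∈Y)

  F⇒Accepts : {X : BS k} {a : List (FIN k)} → F a → Accepts X a
  F⇒Accepts Fa = accepts λ where C ((n , rC≡a) , _) → n , subst F (sym rC≡a) Fa

  Rejects⇒¬Accepts : {X : BS k} {a : List (FIN k)} → H X → Restr X a → Rejects X a → ¬ Accepts X a
  Rejects⇒¬Accepts {X} HX a∈X rej = rej X HX a∈X (λ C C∈X → C∈X)

  H-meets-Cone : {Y C : BS k} {a : List (FIN k)} → H Y → Cone a Y C → ∃ λ W → H W × Cone a Y W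
  H-meets-Cone {Y} {C} HY ((n , rC≡a) , C≤Y) = W' , H-finDiff HY finDiff , (n , trans r-W' rC≡a) , W'≤W C≤Y
    where open Splice Y C n

  Cone-self : {Y W : BS k} {a : List (FIN k)} → Cone a Y W → Cone a W W
  Cone-self {W = W} (a⊑W , _) = a⊑W , ≤ᴮ-refl W

  Decided : BS k → List (FIN k) → BS k → Set
  Decided A a X = H X × (∃ λ d → Depth A a d × ConeN d A X) × (Accepts X a ⊎ RejectsBelow X a)

  Decided-denseOpen : (A : BS k) → H A → (a : List (FIN k)) → Restr A a → (d : ℕ) → Depth A a d →
                      DenseOpen (Decided A a) (λ X → H X × ConeN d A X)
  Decided-denseOpen A HA a a∈A d depth = sound , dense , open-downward
    where
    sound : (X : BS k) → Decided A a X → H X × ConeN d A X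
    sound X (HX , (d' , depth' , X∈A) , _) =
      HX , subst (λ n → ConeN n A X) (Depth-unique {A = A} {a = a} depth' depth) X∈A

    open-downward : (X Y : BS k) → H X × ConeN d A X → Decided A a Y → X ≤ᴮ Y → Decided A a X
    open-downward X Y (HX , X∈A) (_ , _ , inj₁ acc) X≤Y =
      HX , (d , depth , X∈A) , inj₁ (Accepts-⊆ (≤ᴮ⇒⊆ X Y X≤Y) acc)
    open-downward X Y (HX , X∈A) (_ , _ , inj₂ rej) X≤Y =
      HX , (d , depth , X∈A) , inj₂ (λ Z HZ Z≤X → rej Z HZ (≤ᴮ-trans {C = Z} {X} {Y} Z≤X X≤Y))

    -- Either no Y ≤ X in H accepts a, or (c) shrinks X to some A' ∈ [d, A] whose cone at a lies in Y's.
    dense : (X : BS k) → H X × ConeN d A X → ∃ λ Y → Decided A a Y × Y ≤ᴮ X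
    dense X (HX , X∈A) with decide (∃ λ Y → H Y × Y ≤ᴮ X × Restr Y a × Accepts Y a)
    ... | no none =
      X , (HX , (d , depth , X∈A) , inj₂ (λ Y HY Y≤X a∈Y acc → none (Y , HY , Y≤X , a∈Y , acc))) , ≤ᴮ-refl X
    ... | yes (Y , HY , Y≤X , a∈Y , acc) with restrict-to-ConeN HA a∈A depth X∈A HX
    ...   | a∈X , depthX with H-cone-shrink HX a∈X depthX Y HY Y≤X a∈Y
    ...     | A' , A'∈X , HA' , _ , A'⊆Y =
      A' , (HA' , (d , depth , ConeN-trans d A'∈X X∈A) , inj₁ (Accepts-⊆ A'⊆Y acc)) , proj₂ A'∈X

  accepts-or-rejects : (A B : BS k) →
                       ((b : List (FIN k)) → Restr B b → ∃ λ Ab → Decided A b Ab × B ⊆[ b ] Ab) →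
                       (b : List (FIN k)) → Restr B b → Accepts B b ⊎ Rejects B b
  accepts-or-rejects A B select b b∈B with select b b∈B
  ... | Ab , (_ , _ , inj₁ acc) , B⊆Ab = inj₁ (Accepts-⊆ B⊆Ab acc)
  ... | Ab , (_ , _ , inj₂ rej) , B⊆Ab = inj₂ reject
    where
    reject : Rejects B b
    reject Y HY (C , C∈Y) Y⊆B acc with H-meets-Cone HY C∈Y
    ... | W , HW , W∈Y =
      rej W HW (proj₂ (B⊆Ab W (Y⊆B W W∈Y))) (W , Cone-self {Y} W∈Y)
          (Accepts-⊆ (≤ᴮ⇒⊆ W Y (proj₂ W∈Y)) acc)

  SuccessorsDecided : BS k → List (FIN k) → BS k → Set
  SuccessorsDecided B a X =
    H X × (∃ λ d → Depth B a d × ConeN d B X) ×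
    (Accepts B a ⊎ ((b : List (FIN k)) → rCone (suc (length a)) a X b → Rejects B b))

  SuccessorsDecided-denseOpen : (B : BS k) → H B →
                                ((b : List (FIN k)) → Restr B b → Accepts B b ⊎ Rejects B b) →
                                (a : List (FIN k)) → Restr B a → (d : ℕ) → Depth B a d →
                                DenseOpen (SuccessorsDecided B a) (λ X → H X × ConeN d B X)
  SuccessorsDecided-denseOpen B HB decided a a∈B d depth = sound , dense , open-downward
    where
    sound : (X : BS k) → SuccessorsDecided B a X → H X × ConeN d B X
    sound X (HX , (d' , depth' , X∈B) , _) =
      HX , subst (λ n → ConeN n B X) (Depth-unique {A = B} {a = a} depth' depth) X∈B

    open-downward : (X Y : BS k) → H X × ConeN d B X → SuccessorsDecided B a Y → X ≤ᴮ Y →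
                    SuccessorsDecided B a X
    open-downward X Y (HX , X∈B) (_ , _ , inj₁ acc) X≤Y = HX , (d , depth , X∈B) , inj₁ acc
    open-downward X Y (HX , X∈B) (_ , _ , inj₂ rej) X≤Y =
      HX , (d , depth , X∈B) , inj₂ λ where b (C , C∈X , rC≡b) → rej b (C , ≤ᴮ⇒⊆ X Y X≤Y C C∈X , rC≡b)

    -- (d) yields W ∈ [d, X] whose one-step extensions of a are all or none accepted by B;
    -- in the first case W would accept a, contradicting that B rejects a.
    dense : (X : BS k) → H X × ConeN d B X → ∃ λ Y → SuccessorsDecided B a Y × Y ≤ᴮ X
    dense X (HX , X∈B) with decided a a∈B | restrict-to-ConeN HB a∈B depth X∈B HX
    ... | inj₁ acc | _ = X , (HX , (d , depth , X∈B) , inj₁ acc) , ≤ᴮ-refl X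
    ... | inj₂ rej | a∈X , depthX with H-one-step HX a∈X depthX (Accepts B)
    ...   | W , W∈X , HW , inj₁ all-accepted =
      ⊥-elim (rej W HW (H-cone-nonempty HX a∈X depthX W W∈X HW) (≤ᴮ⇒⊆ W B W≤B) (accepts W-accepts))
      where
      W≤B : W ≤ᴮ B
      W≤B = ≤ᴮ-trans {C = W} {X} {B} (proj₂ W∈X) (proj₂ X∈B)
      W-accepts : (C : BS k) → Cone a W C → ∃ λ n → F (r n C)
      W-accepts C C∈W = prefix-in-F (all-accepted (r (suc (length a)) C) (C , C∈W , refl)) C
                          ((suc (length a) , refl) , ≤ᴮ-trans {C = C} {W} {B} (proj₂ C∈W) W≤B)
    ...   | W , W∈X , HW , inj₂ none-accepted =
      W , (HW , (d , depth , ConeN-trans d W∈X X∈B) , inj₂ successors-rejected) , proj₂ W∈X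
      where
      successors-rejected : (b : List (FIN k)) → rCone (suc (length a)) a W b → Rejects B b
      successors-rejected b (C , C∈W , rC≡b)
        with decided b (C , (suc (length a) , rC≡b) ,
                        ≤ᴮ-trans {C = C} {W} {B} (proj₂ C∈W) (proj₂ (ConeN-trans d W∈X X∈B)))
      ... | inj₁ acc = ⊥-elim (none-accepted b (C , C∈W , rC≡b) acc)
      ... | inj₂ rej′ = rej′

  module _ {B B' : BS k} (HB : H B) (B'≤B : B' ≤ᴮ B)
           (select : (a : List (FIN k)) → Restr B' a → ∃ λ Aₐ → SuccessorsDecided B a Aₐ × B' ⊆[ a ] Aₐ) where

    rejects-prefixes : Rejects B [] → (C : BS k) → C ≤ᴮ B' → (n : ℕ) → Rejects B (r n C)
    rejects-prefixes rej C C≤B' zero = rej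
    rejects-prefixes rej C C≤B' (suc n) with select (r n C) (C , (n , refl) , C≤B')
    ... | _ , (_ , _ , inj₁ acc) , _ =
      ⊥-elim (Rejects⇒¬Accepts HB (C , (n , refl) , ≤ᴮ-trans {C = C} {B'} {B} C≤B' B'≤B)
                                 (rejects-prefixes rej C C≤B' n) acc)
    ... | _ , (_ , _ , inj₂ successors-rejected) , B'⊆Aₐ =
      subst (λ m → Rejects B (r (suc m) C)) (length-rFrom C n 0)
        (successors-rejected _ (C , B'⊆Aₐ C ((n , refl) , C≤B') , refl))

    rejects-prefixes⇒avoids-F : Rejects B [] → (a : List (FIN k)) → Restr B' a → ¬ F a
    rejects-prefixes⇒avoids-F rej a (C , (n , rC≡a) , C≤B') Fa =
      Rejects⇒¬Accepts HB (C , (n , rC≡a) , ≤ᴮ-trans {C = C} {B'} {B} C≤B' B'≤B)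
        (subst (Rejects B) rC≡a (rejects-prefixes rej C C≤B' n)) (F⇒Accepts Fa)

lemma3p4 : ExcludedMiddle (lsuc 0ℓ) →
    (k : ℕ) → 1 ≤ k →
    (F : List (FIN k) → Set) →
    (H : BS k → Set) → IsCoideal H → IsSemiselective H →
    (A : BS k) → H A →
    ∃ λ B → H B × B ≤ᴮ A ×
      (((a : List (FIN k)) → Restr B a → ¬ F a)
       ⊎ ((C : BS k) → C ≤ᴮ B → ∃ λ n → F (r n C)))
lemma3p4 em k _ F H coideal semiselective A HA =
  let B , HB , B≤A , selectB = semiselective A HA (Decided A) (Decided-denseOpen A HA) A HA (≤ᴮ-refl A)
  in case accepts-or-rejects A B selectB [] (B , (0 , refl) , ≤ᴮ-refl B) of λ where
    (inj₁ acc) → B , HB , B≤A , inj₂ (λ C C≤B → prefix-in-F acc C ((0 , refl) , C≤B))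
    (inj₂ rej) →
      let decided = accepts-or-rejects A B selectB
          B' , HB' , B'≤B , selectB' =
            semiselective B HB (SuccessorsDecided B) (SuccessorsDecided-denseOpen B HB decided) B HB (≤ᴮ-refl B)
      in B' , HB' , ≤ᴮ-trans {C = B'} {B} {A} B'≤B B≤A ,
         inj₁ (rejects-prefixes⇒avoids-F {B = B} {B'} HB B'≤B selectB' rej)
  where open Dichotomy em F H coideal
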